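{- Let $P$ be a finite interval order, $f$ a circulation of its key graph $G_P$, and $C_1,\dots,C_t$ ($t\ge2$) concordant cycles in $\mathrm{supp}(f)$. If $\bigcup_{i=1}^tC_i$ contains no discordant cycle, then all the cycles $C_1,\dots,C_t$ visit the basic vertices of $\mathrm{supp}(f)$ in the same circular order.
   Context: A finite partial order $P=([n],\prec)$ is an interval order if there are compact real intervals $I_x=[\ell_x,r_x]$ with $x\prec y$ iff $r_x<\ell_y$; write $x\parallel y$ if $x\ne y$ are incomparable. The canonical representation $[\ell_x,r_x]_{x\in[n]}$ of $P$ is the (unique) representation using the minimum number $m$ of distinct endpoints, placed at $0,\dots,m-1$. For $y\not\prec x$, the slack of $(x,y)$ there is $\ell_y-r_x-1$ if $x\prec y$, $r_y-\ell_x$ if $x\parallel y$, $r_x-\ell_x$ if $x=y$; slack-$0$ pairs are slack zero pairs, called cover pairs if $x\prec y$ and sharp pairs if $x\parallel y$. The key graph $G_P$ has vertex set $\{\rho_1,\dots,\rho_n\}$ and colored arcs, each with a weight that is a linear inequality in $\ell_1,\dots,\ell_n,\rho_1,\dots,\rho_n$: a blue arc $\rho_x\to\rho_y$ of weight $\langle\ell_x+\rho_x+1\le\ell_y\rangle$ for each slack zero cover pair; a red arc $\rho_x\to\rho_y$ of weight $\langle\ell_x\le\ell_y+\rho_y\rangle$ for each slack zero sharp pair; a red loop at $\rho_x$ of weight $\langle-\rho_x\le0\rangle$ for each slack zero pair $(x,x)$. Inequalities are added termwise and scaled by nonnegative scalars, with cancellation of terms occurring on both sides. A circulation is a map $f$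 from arcs to $\mathbb R_{\ge0}$ with flow conservation at every vertex; $\mathrm{supp}(f)$ is the subgraph of arcs with nonzero flow; $W(f)=\sum_af(a)w(a)$ (all $\ell$-variables cancel, leaving an inequality in the $\rho$'s). A directed cycle $C$ is identified with the circulation equal to $1$ on its arcs; $W(C)$ is its cycle inequality. A cycle $C$ in $\mathrm{supp}(f)$ is concordant if $W(C)=W(f)$ and discordant otherwise. A vertex $\rho_x$ of $\mathrm{supp}(f)$ is basic if $\rho_x$ has nonzero coefficient in $W(f)$.
   Formalization: The circulation f takes values in the nonnegative rationals instead of the nonnegative reals. -}

module Defs where

open import Data.Nat as ℕ using (ℕ; suc)
open import Data.Fin using (Fin) renaming (_≟_ to _≟F_)
open import Data.Rational as ℚ using (ℚ; 0ℚ; 1ℚ) renaming (_≟_ to _≟Q_)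
open import Data.List using (List; []; _∷_; map; concatMap; allFin; foldr; filter; drop; take; _++_)
open import Data.List.Relation.Unary.Any using (Any; any?)
open import Data.List.Relation.Unary.All using (All)
open import Data.List.Relation.Unary.Unique.Propositional using (Unique)
open import Data.Bool using (Bool; if_then_else_)
open import Data.Product using (Σ; _×_; ∃)
open import Data.Sum using (_⊎_)
open import Relation.Nullary using (¬_; Dec; does)
open import Relation.Nullary.Decidable using (_×-dec_; ¬?; _⊎-dec_)
open import Relation.Binary.PropositionalEquality using (_≡_; _≢_)

-- (ℓ , r) is a representation of the order prec on [n] = Fin n:
-- intervals [ℓ x, r x] (ℓ x ≤ r x) with  x ≺ y  iff  r x < ℓ y.
record IsRepOf {n : ℕ} (prec : Fin n → Fin n → Set) (ℓ r : Fin n → ℕ) : Set where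
  field
    ordered : ∀ x → ℓ x ℕ.≤ r x
    sound   : ∀ x y → prec x y → r x ℕ.< ℓ y
    complete : ∀ x y → r x ℕ.< ℓ y → prec x y

EndpointsExactly : {n : ℕ} → ℕ → (ℓ r : Fin n → ℕ) → Set
EndpointsExactly {n} k ℓ r =
  (∀ x → ℓ x ℕ.< k × r x ℕ.< k) ×
  (∀ j → j ℕ.< k → ∃ λ (x : Fin n) → ℓ x ≡ j ⊎ r x ≡ j)

record IsCanonicalRep {n : ℕ} (prec : Fin n → Fin n → Set) (m : ℕ) (ℓ r : Fin n → ℕ) : Set where
  field
    rep : IsRepOf prec ℓ r
    endpoints : EndpointsExactly m ℓ r
    minimal : ∀ k (ℓ' r' : Fin n → ℕ) → IsRepOf prec ℓ' r' → EndpointsExactly k ℓ' r' → m ℕ.≤ k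

module _ {n : ℕ} (prec : Fin n → Fin n → Set) (ℓ r : Fin n → ℕ) where

  -- slack ℓ y - r x - 1 = 0 for x ≺ y
  CoverZero : Fin n → Fin n → Set
  CoverZero x y = prec x y × ℓ y ≡ suc (r x)

  -- slack r y - ℓ x = 0 for x ∥ y
  SharpZero : Fin n → Fin n → Set
  SharpZero x y = x ≢ y × ¬ prec x y × ¬ prec y x × r y ≡ ℓ x

  -- slack r x - ℓ x = 0 for the pair (x , x)
  LoopZero : Fin n → Set
  LoopZero x = r x ≡ ℓ x

data Arc (n : ℕ) : Set where
  blue : Fin n → Fin n → Arc n
  red  : Fin n → Fin n → Arc n
  loop : Fin n → Arc n

tail : {n : ℕ} → Arc n → Fin n
tail (blue x y) = x
tail (red x y) = x
tail (loop x) = x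

head : {n : ℕ} → Arc n → Fin n
head (blue x y) = y
head (red x y) = y
head (loop x) = x

-- all potential arcs (each arc of G_P occurs exactly once)
allArcs : (n : ℕ) → List (Arc n)
allArcs n =
  concatMap (λ x → map (blue x) (allFin n)) (allFin n) ++
  concatMap (λ x → map (red x) (allFin n)) (allFin n) ++
  map loop (allFin n)

InKeyGraph : {n : ℕ} (prec : Fin n → Fin n → Set) (ℓ r : Fin n → ℕ) → Arc n → Set
InKeyGraph prec ℓ r (blue x y) = CoverZero prec ℓ r x y
InKeyGraph prec ℓ r (red x y) = SharpZero prec ℓ r x y
InKeyGraph prec ℓ r (loop x) = LoopZero prec ℓ r x

-- Linear inequalities in ℓ₁…ℓₙ, ρ₁…ρₙ, normalised (after cancellation)
-- as  Σ lc x · ℓ_x + Σ rc x · ρ_x + k ≤ 0   (i.e. LHS − RHS ≤ 0).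

record Ineq (n : ℕ) : Set where
  field
    lc : Fin n → ℚ
    rc : Fin n → ℚ
    k  : ℚ
open Ineq public

_≈I_ : {n : ℕ} → Ineq n → Ineq n → Set
_≈I_ {n} a b = (∀ x → lc a x ≡ lc b x) × (∀ x → rc a x ≡ rc b x) × k a ≡ k b

0I : {n : ℕ} → Ineq n
0I = record { lc = λ _ → 0ℚ ; rc = λ _ → 0ℚ ; k = 0ℚ }

_⊕_ : {n : ℕ} → Ineq n → Ineq n → Ineq n
a ⊕ b = record { lc = λ x → lc a x ℚ.+ lc b x ; rc = λ x → rc a x ℚ.+ rc b x ; k = k a ℚ.+ k b }

_⊙_ : {n : ℕ} → ℚ → Ineq n → Ineq n
c ⊙ a = record { lc = λ x → c ℚ.* lc a x ; rc = λ x → c ℚ.* rc a x ; k = c ℚ.* k a }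

unit : {n : ℕ} → Fin n → Fin n → ℚ
unit x z = if does (z ≟F x) then 1ℚ else 0ℚ

weight : {n : ℕ} → Arc n → Ineq n
-- ⟨ ℓx + ρx + 1 ≤ ℓy ⟩
weight (blue x y) = record { lc = λ z → unit x z ℚ.- unit y z ; rc = unit x ; k = 1ℚ }
-- ⟨ ℓx ≤ ℓy + ρy ⟩
weight (red x y) = record { lc = λ z → unit x z ℚ.- unit y z ; rc = λ z → ℚ.- unit y z ; k = 0ℚ }
-- ⟨ -ρx ≤ 0 ⟩
weight (loop x) = record { lc = λ _ → 0ℚ ; rc = λ z → ℚ.- unit x z ; k = 0ℚ }

sumℚ : List ℚ → ℚ
sumℚ = foldr ℚ._+_ 0ℚ

inflow : {n : ℕ} → (Arc n → ℚ) → Fin n → ℚ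
inflow {n} f v = sumℚ (map (λ a → if does (head a ≟F v) then f a else 0ℚ) (allArcs n))

outflow : {n : ℕ} → (Arc n → ℚ) → Fin n → ℚ
outflow {n} f v = sumℚ (map (λ a → if does (tail a ≟F v) then f a else 0ℚ) (allArcs n))

record IsCirculation {n : ℕ} (prec : Fin n → Fin n → Set) (ℓ r : Fin n → ℕ)
                     (f : Arc n → ℚ) : Set where
  field
    nonneg   : ∀ a → 0ℚ ℚ.≤ f a
    onArcs   : ∀ a → ¬ InKeyGraph prec ℓ r a → f a ≡ 0ℚ
    conserve : ∀ v → inflow f v ≡ outflow f v

Wf : {n : ℕ} → (Arc n → ℚ) → Ineq n
Wf {n} f = foldr (λ a acc → (f a ⊙ weight a) ⊕ acc) 0I (allArcs n)

InSupp : {n : ℕ} → (Arc n → ℚ) → Arc n → Set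
InSupp f a = f a ≢ 0ℚ

-- Directed cycles, given as the (cyclic) list of their arcs

Path : {n : ℕ} → Fin n → List (Arc n) → Fin n → Set
Path u [] v = u ≡ v
Path u (a ∷ as) v = tail a ≡ u × Path (head a) as v

IsCycle : {n : ℕ} → List (Arc n) → Set
IsCycle [] = Data.Empty.⊥
  where import Data.Empty
IsCycle (a ∷ as) = Path (tail a) (a ∷ as) (tail a) × Unique (map tail (a ∷ as))

-- the cycle inequality W(C) (C seen as the 0/1 circulation on its arcs)
WC : {n : ℕ} → List (Arc n) → Ineq n
WC = foldr (λ a acc → weight a ⊕ acc) 0I

CycleIn : {n : ℕ} → (Arc n → ℚ) → List (Arc n) → Set
CycleIn f C = IsCycle C × All (InSupp f) C

Concordant : {n : ℕ} → (Arc n → ℚ) → List (Arc n) → Set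
Concordant f C = WC C ≈I Wf f

-- ρ_x is a vertex of supp(f)
VertexInSupp : {n : ℕ} → (Arc n → ℚ) → Fin n → Set
VertexInSupp {n} f x = Any (λ a → InSupp f a × (tail a ≡ x ⊎ head a ≡ x)) (allArcs n)

Basic : {n : ℕ} → (Arc n → ℚ) → Fin n → Set
Basic f x = VertexInSupp f x × rc (Wf f) x ≢ 0ℚ

basic? : {n : ℕ} (f : Arc n → ℚ) (x : Fin n) → Dec (Basic f x)
basic? {n} f x =
  any? (λ a → ¬? (f a ≟Q 0ℚ) ×-dec ((tail a ≟F x) ⊎-dec (head a ≟F x))) (allArcs n)
  ×-dec ¬? (rc (Wf f) x ≟Q 0ℚ)

basicSeq : {n : ℕ} → (Arc n → ℚ) → List (Arc n) → List (Fin n)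
basicSeq f C = filter (basic? f) (map tail C)

Rotation : {A : Set} → List A → List A → Set
Rotation xs ys = ∃ λ (j : ℕ) → ys ≡ drop j xs ++ take j xs

{-# OPTIONS --safe #-}
module Submission where

-- Let U be the union of the cycles C i. Every closed walk in U passes through every basic vertex
-- c: the walk contains a cycle D, concordant by hypothesis, and the coefficient of ρ_c in W(D)
-- vanishes unless D visits c. Rotate C i and C j to start at a common basic vertex u. If y comes
-- before x on C j, then going along C i from u to x and along C j from x back to u is a closed
-- walk in U; it visits y, and not on its C j part, since C j visits y only once. So y also comes
-- before x on C i, and two duplicate-free lists with the same elements and compatible orders agree.

open import Defs
open import Data.Nat using (ℕ; _≤_)
open import Data.Fin using (Fin) renaming (_≟_ to _≟F_)
open import Data.Rational using (ℚ; 0ℚ)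
open import Data.List using (List; []; _∷_; _++_; [_]; map; filter; drop; take; length)
open import Data.List.Properties
  using (map-++; filter-++; filter-accept; filter-reject; ++-identityʳ; ∷-injectiveˡ)
open import Data.List.Relation.Unary.All as All using (All; []; _∷_)
open import Data.List.Relation.Unary.All.Properties using (anti-mono; ¬Any⇒All¬)
import Data.List.Relation.Unary.All.Properties as All
open import Data.List.Relation.Unary.Any using (here; there)
open import Data.List.Relation.Unary.Unique.Propositional using (Unique; []; _∷_)
open import Data.List.Relation.Unary.Unique.Propositional.Properties using (filter⁺; Unique[x∷xs]⇒x∉xs)
open import Data.List.Membership.Propositional using (_∈_; _∉_)
open import Data.List.Membership.Propositional.Properties
  using (∈-map⁻; ∈-++⁺ˡ; ∈-++⁺ʳ; ∈-++⁻; ∈-filter⁺; ∈-filter⁻; ∈-∃++)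
import Data.List.Membership.DecPropositional as DecMembership
open import Data.List.Relation.Binary.Subset.Propositional using (_⊆_)
open import Data.List.Relation.Binary.Subset.Propositional.Properties using (⊆[]⇒≡[])
import Data.List.Relation.Binary.Subset.Propositional.Properties as ⊆
import Data.List.Relation.Binary.Disjoint.Propositional as Disjoint
open import Data.List.Relation.Binary.Permutation.Propositional using (↭⇒↭ₛ)
open import Data.List.Relation.Binary.Permutation.Propositional.Properties using (++-comm)
import Data.List.Relation.Binary.Permutation.Propositional.Properties as ↭
open import Data.List.Relation.Binary.Permutation.Setoid.Properties using (Unique-resp-↭)
open import Data.Product using (∃; ∃₂; _×_; _,_; proj₁; proj₂)
open import Data.Sum using (_⊎_; inj₁; inj₂)
open import Function using (_∘_; id)
open import Relation.Nullary using (yes; no; contradiction)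
open import Relation.Unary using (Decidable)
open import Relation.Binary.PropositionalEquality
  using (_≡_; _≢_; refl; sym; trans; cong; cong₂; subst; subst₂; setoid; module ≡-Reasoning)

module _ {A : Set} where

  open Disjoint {A = A} using (Disjoint)

  data Before (y x : A) : List A → Set where
    before-here  : ∀ {zs} → x ∈ zs → Before y x (y ∷ zs)
    before-there : ∀ {z zs} → Before y x zs → Before y x (z ∷ zs)

  Before⇒∈ˡ : ∀ {y x xs} → Before y x xs → y ∈ xs
  Before⇒∈ˡ (before-here _)  = here refl
  Before⇒∈ˡ (before-there b) = there (Before⇒∈ˡ b)

  Before⇒∈ʳ : ∀ {y x xs} → Before y x xs → x ∈ xs
  Before⇒∈ʳ (before-here x∈)  = there x∈
  Before⇒∈ʳ (before-there b) = there (Before⇒∈ʳ b)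

  Before-++ : ∀ {y x ys zs} → y ∈ ys → Before y x (ys ++ x ∷ zs)
  Before-++ {ys = _ ∷ ys} (here refl) = before-here (∈-++⁺ʳ ys (here refl))
  Before-++ (there y∈ys) = before-there (Before-++ y∈ys)

  module _ {P : A → Set} (P? : Decidable P) where

    Before-filter⁻ : ∀ {y x} xs → Before y x (filter P? xs) → Before y x xs
    Before-filter⁻ (z ∷ zs) b with P? z | b
    ... | yes _ | before-here x∈  = before-here (proj₁ (∈-filter⁻ P? x∈))
    ... | yes _ | before-there b′ = before-there (Before-filter⁻ zs b′)
    ... | no _  | b′              = before-there (Before-filter⁻ zs b′)

    Before-filter⁺ : ∀ {y x xs} → P y → P x → Before y x xs → Before y x (filter P? xs)
    Before-filter⁺ {xs = z ∷ zs} py px b with P? z | b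
    ... | yes _   | before-here x∈ = before-here (∈-filter⁺ P? x∈ px)
    ... | yes _   | before-there b′ = before-there (Before-filter⁺ py px b′)
    ... | no ¬py  | before-here _  = contradiction py ¬py
    ... | no _    | before-there b′ = Before-filter⁺ py px b′

  Unique-++⇒Disjoint : ∀ (xs : List A) {ys} → Unique (xs ++ ys) → Disjoint xs ys
  Unique-++⇒Disjoint (x ∷ xs) (x∉ ∷ _) (here refl , x∈ys) = All.lookup (All.++⁻ʳ xs x∉) x∈ys refl
  Unique-++⇒Disjoint (x ∷ xs) (_ ∷ u) (there v∈xs , v∈ys) = Unique-++⇒Disjoint xs u (v∈xs , v∈ys)

  Unique[xs++y∷ys]⇒Unique[y∷xs] : ∀ (xs : List A) {y ys} → Unique (xs ++ y ∷ ys) → Unique (y ∷ xs)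
  Unique[xs++y∷ys]⇒Unique[y∷xs] [] _ = [] ∷ []
  Unique[xs++y∷ys]⇒Unique[y∷xs] (x ∷ xs) (x∉ ∷ u) with Unique[xs++y∷ys]⇒Unique[y∷xs] xs u
  ... | y∉xs ∷ xs-unique =
    ((λ y≡x → All.lookup (All.++⁻ʳ xs x∉) (here refl) (sym y≡x)) ∷ y∉xs) ∷ All.++⁻ˡ xs x∉ ∷ xs-unique

  Unique-map-++-comm : ∀ {B : Set} (g : B → A) (xs ys : List B) →
                       Unique (map g (xs ++ ys)) → Unique (map g (ys ++ xs))
  Unique-map-++-comm g xs ys = Unique-resp-↭ (setoid A) (↭⇒↭ₛ (↭.map⁺ g (++-comm xs ys)))

  ∈-map-split : ∀ {B : Set} (g : B → A) {x} ws → x ∈ map g ws →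
                ∃₂ λ us vs → ∃ λ w → ws ≡ us ++ w ∷ vs × g w ≡ x
  ∈-map-split g ws x∈ with w , w∈ws , refl ← ∈-map⁻ g x∈ with us , vs , ws≡ ← ∈-∃++ w∈ws =
    us , vs , w , ws≡ , refl

  Before-map⁻ : ∀ {B : Set} (g : B → A) {y x} ws → Before y x (map g ws) →
                ∃₂ λ us vs → ∃ λ w → ws ≡ us ++ w ∷ vs × g w ≡ x × y ∈ map g us
  Before-map⁻ g (w ∷ ws) (before-here x∈) with us , vs , v , refl , gv≡x ← ∈-map-split g ws x∈ =
    w ∷ us , vs , v , refl , gv≡x , here refl
  Before-map⁻ g (w ∷ ws) (before-there b) with us , vs , v , refl , gv≡x , y∈ ← Before-map⁻ g ws b =
    w ∷ us , vs , v , refl , gv≡x , there y∈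

  ≡-by-order : ∀ {xs ys} → Unique xs → Unique ys → xs ⊆ ys → ys ⊆ xs →
               (∀ {y x} → Before y x ys → Before y x xs) → xs ≡ ys
  ≡-by-order {[]} _ _ _ ys⊆[] _ = sym (⊆[]⇒≡[] ys⊆[])
  ≡-by-order {s ∷ xs} xs-unique ys-unique xs⊆ys ys⊆xs order with xs⊆ys (here refl)
  ... | there s∈ys with order (before-here s∈ys)
  ...   | before-here _  = contradiction s∈ys (Unique[x∷xs]⇒x∉xs ys-unique)
  ...   | before-there b = contradiction (Before⇒∈ʳ b) (Unique[x∷xs]⇒x∉xs xs-unique)
  ≡-by-order {s ∷ xs} {s ∷ ys} (s∉xs ∷ xs-unique) (s∉ys ∷ ys-unique) xs⊆ys ys⊆xs order | here refl =
    cong (s ∷_) (≡-by-order xs-unique ys-unique (drop-head s∉xs xs⊆ys) (drop-head s∉ys ys⊆xs) order′)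
    where
    drop-head : ∀ {us vs} → All (s ≢_) us → s ∷ us ⊆ s ∷ vs → us ⊆ vs
    drop-head s∉us s∷us⊆s∷vs u∈us with s∷us⊆s∷vs (there u∈us)
    ... | here refl  = contradiction refl (All.lookup s∉us u∈us)
    ... | there u∈vs = u∈vs
    order′ : ∀ {y x} → Before y x ys → Before y x xs
    order′ b with order (before-there b)
    ... | before-here _   = contradiction refl (All.lookup s∉ys (Before⇒∈ˡ b))
    ... | before-there b′ = b′

  All-++-comm : ∀ {P : A → Set} (xs ys : List A) → All P (xs ++ ys) → All P (ys ++ xs)
  All-++-comm xs ys Pxsys = All.++⁺ (All.++⁻ʳ xs Pxsys) (All.++⁻ˡ xs Pxsys)

  drop-length-++ : ∀ (ys xs : List A) → drop (length ys) (ys ++ xs) ≡ xs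
  drop-length-++ []       xs = refl
  drop-length-++ (y ∷ ys) xs = drop-length-++ ys xs

  take-length-++ : ∀ (ys xs : List A) → take (length ys) (ys ++ xs) ≡ ys
  take-length-++ []       xs = refl
  take-length-++ (y ∷ ys) xs = cong (y ∷_) (take-length-++ ys xs)

  rotation-++ : ∀ (xs ys : List A) → Rotation (ys ++ xs) (xs ++ ys)
  rotation-++ xs ys = length ys , sym (cong₂ _++_ (drop-length-++ ys xs) (take-length-++ ys xs))

module _ {n : ℕ} where

  open DecMembership (_≟F_ {n}) using (_∈?_)

  path-++ : ∀ {s m v : Fin n} A {B} → Path s A m → Path m B v → Path s (A ++ B) v
  path-++ []      refl     q = q
  path-++ (a ∷ A) (ta , p) q = ta , path-++ A p q

  path-split : ∀ A b B {s v : Fin n} → Path s (A ++ b ∷ B) v →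
               Path s A (tail b) × Path (tail b) (b ∷ B) v
  path-split [] b B (refl , p) = refl , refl , p
  path-split (a ∷ A) b B (ta , p) with pA , pB ← path-split A b B p = (ta , pA) , pB

  path-rotate : ∀ A b B {v : Fin n} → Path v (A ++ b ∷ B) v → Path (tail b) (b ∷ B ++ A) (tail b)
  path-rotate A b B p with pA , (_ , pB) ← path-split A b B p = refl , path-++ B pB pA

  cycle-rotate : ∀ A b B → IsCycle {n} (A ++ b ∷ B) → IsCycle (b ∷ B ++ A)
  cycle-rotate []      b B (p , u) = path-rotate [] b B p , Unique-map-++-comm tail [] (b ∷ B) u
  cycle-rotate (a ∷ A) b B (p , u) = path-rotate (a ∷ A) b B p , Unique-map-++-comm tail (a ∷ A) (b ∷ B) u

  path-splice : ∀ A₁ b₁ B₁ A₂ b₂ B₂ {u : Fin n} → Path u (A₁ ++ b₁ ∷ B₁) u → Path u (A₂ ++ b₂ ∷ B₂) u →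
                tail b₁ ≡ tail b₂ → Path (tail b₂) (b₂ ∷ B₂ ++ A₁) (tail b₂)
  path-splice A₁ b₁ B₁ A₂ b₂ B₂ p₁ p₂ tb₁≡tb₂
    with pA₁ , _ ← path-split A₁ b₁ B₁ p₁ | _ , (_ , pB₂) ← path-split A₂ b₂ B₂ p₂ =
    refl , path-++ B₂ pB₂ (subst (Path _ A₁) tb₁≡tb₂ pA₁)

  path-start∈ : ∀ {s v : Fin n} W → Path s W v → s ∈ map tail W ++ [ v ]
  path-start∈ []      refl       = here refl
  path-start∈ (a ∷ W) (refl , _) = here refl

  path-heads⊆ : ∀ {s v : Fin n} W → Path s W v → map head W ⊆ map tail W ++ [ v ]
  path-heads⊆ (a ∷ W) (_ , p) (here refl)  = there (path-start∈ W p)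
  path-heads⊆ (a ∷ W) (_ , p) (there h∈W) = there (path-heads⊆ W p h∈W)

  closed-walk-heads⊆tails : ∀ {u : Fin n} a W → Path u (a ∷ W) u → map head (a ∷ W) ⊆ map tail (a ∷ W)
  closed-walk-heads⊆tails a W p h∈ with ∈-++⁻ (map tail (a ∷ W)) (path-heads⊆ (a ∷ W) p h∈)
  ... | inj₁ h∈tails     = h∈tails
  ... | inj₂ (here refl) = here (sym (proj₁ p))

  HasCycle : List (Arc n) → Set
  HasCycle W = ∃ λ D → IsCycle D × D ⊆ W

  simple-or-cycle : ∀ {s v : Fin n} W → Path s W v → Unique (v ∷ map tail W) ⊎ HasCycle W
  simple-or-cycle [] refl = inj₁ ([] ∷ [])
  simple-or-cycle {v = v} (a ∷ W) (refl , p) with simple-or-cycle W p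
  ... | inj₂ (D , D-cycle , D⊆W) = inj₂ (D , D-cycle , there ∘ D⊆W)
  ... | inj₁ (v∉W ∷ W-simple) with tail a ≟F v | tail a ∈? map tail W
  ...   | yes refl | _ = inj₂ (a ∷ W , ((refl , p) , v∉W ∷ W-simple) , id)
  ...   | no a≢v | no a∉W = inj₁ ((a≢v ∘ sym ∷ v∉W) ∷ ¬Any⇒All¬ _ a∉W ∷ W-simple)
  ...   | no _ | yes a∈W with A , B , b , refl , tb≡ta ← ∈-map-split tail W a∈W =
    inj₂ (a ∷ A , ((refl , A-path) , A-simple) , prefix⊆)
    where
    A-path : Path (head a) A (tail a)
    A-path = subst (Path (head a) A) tb≡ta (proj₁ (path-split A b B p))
    A-simple : Unique (tail a ∷ map tail A)
    A-simple = subst (λ x → Unique (x ∷ map tail A)) tb≡ta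
      (Unique[xs++y∷ys]⇒Unique[y∷xs] (map tail A) (subst Unique (map-++ tail A (b ∷ B)) W-simple))
    prefix⊆ : a ∷ A ⊆ a ∷ A ++ b ∷ B
    prefix⊆ (here refl) = here refl
    prefix⊆ (there d∈A) = there (∈-++⁺ˡ d∈A)

  closed-walk-has-cycle : ∀ {u : Fin n} a W → Path u (a ∷ W) u → HasCycle (a ∷ W)
  closed-walk-has-cycle a W p with simple-or-cycle (a ∷ W) p
  ... | inj₂ cycle = cycle
  ... | inj₁ ((u≢a ∷ _) ∷ _) = contradiction (sym (proj₁ p)) u≢a

  rc-weight-≡0 : ∀ {c} a → c ≢ tail a → c ≢ head a → rc (weight {n} a) c ≡ 0ℚ
  rc-weight-≡0 {c} (blue x y) c≢x _ with c ≟F x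
  ... | yes c≡x = contradiction c≡x c≢x
  ... | no _    = refl
  rc-weight-≡0 {c} (red x y) _ c≢y with c ≟F y
  ... | yes c≡y = contradiction c≡y c≢y
  ... | no _    = refl
  rc-weight-≡0 {c} (loop x) c≢x _ with c ≟F x
  ... | yes c≡x = contradiction c≡x c≢x
  ... | no _    = refl

  rc-WC-≡0 : ∀ {c} D → c ∉ map tail D → c ∉ map head D → rc (WC {n} D) c ≡ 0ℚ
  rc-WC-≡0 []      _        _        = refl
  rc-WC-≡0 (a ∷ D) c∉tails c∉heads
    rewrite rc-weight-≡0 a (c∉tails ∘ here) (c∉heads ∘ here)
          | rc-WC-≡0 D (c∉tails ∘ there) (c∉heads ∘ there) = refl

  basicSeq-++ : ∀ (f : Arc n → ℚ) X Y → basicSeq f (X ++ Y) ≡ basicSeq f X ++ basicSeq f Y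
  basicSeq-++ f X Y =
    trans (cong (filter (basic? f)) (map-++ tail X Y)) (filter-++ (basic? f) (map tail X) (map tail Y))

  ∈-basicSeq⇒Basic : ∀ {f : Arc n → ℚ} {c} W → c ∈ basicSeq f W → Basic f c
  ∈-basicSeq⇒Basic {f} W c∈ = proj₂ (∈-filter⁻ (basic? f) {xs = map tail W} c∈)

  basicSeq-≡∷⇒split : ∀ (f : Arc n → ℚ) {u S} W → basicSeq f W ≡ u ∷ S →
                      ∃₂ λ A B → ∃ λ b → W ≡ A ++ b ∷ B × tail b ≡ u × basicSeq f A ≡ []
  basicSeq-≡∷⇒split f (w ∷ W) eq with basic? f (tail w)
  ... | yes bw = [] , W , w , refl , ∷-injectiveˡ (trans (sym (filter-accept (basic? f) bw)) eq) , refl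
  ... | no ¬bw
    with A , B , b , refl , tb≡u , A-nonbasic ←
           basicSeq-≡∷⇒split f W (trans (sym (filter-reject (basic? f) ¬bw)) eq) =
    w ∷ A , B , b , refl , tb≡u , trans (filter-reject (basic? f) ¬bw) A-nonbasic

module _ {n : ℕ} (f : Arc n → ℚ) (U : Arc n → Set)
         (concordant : ∀ D → IsCycle D → All U D → Concordant f D) where

  open DecMembership (_≟F_ {n}) using (_∈?_)

  closed-walk-visits : ∀ {u c} a W → Path u (a ∷ W) u → All U (a ∷ W) →
                       rc (Wf f) c ≢ 0ℚ → c ∈ map tail (a ∷ W)
  closed-walk-visits {c = c} a W p W⊆U rc≢0 with c ∈? map tail (a ∷ W)
  ... | yes c∈W = c∈W
  ... | no c∉W with D , D-cycle , D⊆W ← closed-walk-has-cycle a W p = contradiction rc≡0 rc≢0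
    where
    rc≡0 : rc (Wf f) c ≡ 0ℚ
    rc≡0 = trans (sym (proj₁ (proj₂ (concordant D D-cycle (anti-mono D⊆W W⊆U))) c))
                 (rc-WC-≡0 D (c∉W ∘ ⊆.map⁺ tail D⊆W)
                             (c∉W ∘ closed-walk-heads⊆tails a W p ∘ ⊆.map⁺ head D⊆W))

  cycle-visits : ∀ {c} D → IsCycle D → All U D → rc (Wf f) c ≢ 0ℚ → c ∈ map tail D
  cycle-visits (a ∷ D) (p , _) = closed-walk-visits a D p

  basicSeq⊆cycle : ∀ D V → IsCycle D → All U D → basicSeq f V ⊆ basicSeq f D
  basicSeq⊆cycle D V D-cycle D⊆U c∈ with basic-c ← ∈-basicSeq⇒Basic V c∈ =
    ∈-filter⁺ (basic? f) (cycle-visits D D-cycle D⊆U (proj₂ basic-c)) basic-c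

  before-preserved : ∀ {u y x} W₁ W₂ → Path u W₁ u → Path u W₂ u → All U W₁ → All U W₂ →
                     Unique (map tail W₂) → rc (Wf f) y ≢ 0ℚ → x ∈ map tail W₁ →
                     Before y x (map tail W₂) → Before y x (map tail W₁)
  before-preserved {y = y} W₁ W₂ p₁ p₂ W₁⊆U W₂⊆U W₂-simple rc≢0 x∈W₁ y<x
    with A₂ , B₂ , b₂ , refl , refl , y∈A₂ ← Before-map⁻ tail W₂ y<x
    with A₁ , B₁ , b₁ , refl , tb₁≡tb₂ ← ∈-map-split tail W₁ x∈W₁
    with ∈-++⁻ (map tail (b₂ ∷ B₂)) (subst (y ∈_) (map-++ tail (b₂ ∷ B₂) A₁)
           (closed-walk-visits b₂ (B₂ ++ A₁) (path-splice A₁ b₁ B₁ A₂ b₂ B₂ p₁ p₂ tb₁≡tb₂)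
             (All.++⁺ (All.++⁻ʳ A₂ W₂⊆U) (All.++⁻ˡ A₁ W₁⊆U)) rc≢0))
  ... | inj₁ y∈B₂ = contradiction (y∈A₂ , y∈B₂)
                      (Unique-++⇒Disjoint (map tail A₂) (subst Unique (map-++ tail A₂ (b₂ ∷ B₂)) W₂-simple))
  ... | inj₂ y∈A₁ = subst₂ (Before y) tb₁≡tb₂ (sym (map-++ tail A₁ (b₁ ∷ B₁))) (Before-++ y∈A₁)

  basicSeq-≡-from-same-start : ∀ {b₁ b₂} W₁ W₂ → IsCycle (b₁ ∷ W₁) → IsCycle (b₂ ∷ W₂) →
                               tail b₁ ≡ tail b₂ → All U (b₁ ∷ W₁) → All U (b₂ ∷ W₂) →
                               basicSeq f (b₁ ∷ W₁) ≡ basicSeq f (b₂ ∷ W₂)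
  basicSeq-≡-from-same-start {b₁} {b₂} W₁ W₂ C₁@(p₁ , W₁-simple) C₂@(p₂ , W₂-simple) tb₁≡tb₂ W₁⊆U W₂⊆U =
    ≡-by-order (filter⁺ (basic? f) W₁-simple) (filter⁺ (basic? f) W₂-simple)
      (basicSeq⊆cycle (b₂ ∷ W₂) (b₁ ∷ W₁) C₂ W₂⊆U) (basicSeq⊆cycle (b₁ ∷ W₁) (b₂ ∷ W₂) C₁ W₁⊆U) order
    where
    order : ∀ {y x} → Before y x (basicSeq f (b₂ ∷ W₂)) → Before y x (basicSeq f (b₁ ∷ W₁))
    order y<x with basic-y ← ∈-basicSeq⇒Basic (b₂ ∷ W₂) (Before⇒∈ˡ y<x)
                 | basic-x ← ∈-basicSeq⇒Basic (b₂ ∷ W₂) (Before⇒∈ʳ y<x) =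
      Before-filter⁺ (basic? f) basic-y basic-x
        (before-preserved (b₁ ∷ W₁) (b₂ ∷ W₂) p₁ (subst (λ v → Path v (b₂ ∷ W₂) v) (sym tb₁≡tb₂) p₂)
          W₁⊆U W₂⊆U W₂-simple (proj₂ basic-y) (cycle-visits (b₁ ∷ W₁) C₁ W₁⊆U (proj₂ basic-x))
          (Before-filter⁻ (basic? f) (map tail (b₂ ∷ W₂)) y<x))

  -- Rotating D₁ to start at its first basic vertex leaves its basic sequence unchanged.
  cycles-basicSeq-rotation : ∀ D₁ D₂ → IsCycle D₁ → IsCycle D₂ → All U D₁ → All U D₂ →
                             Rotation (basicSeq f D₁) (basicSeq f D₂)
  cycles-basicSeq-rotation D₁ D₂ C₁ C₂ D₁⊆U D₂⊆U with basicSeq f D₁ in eq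
  ... | [] = 0 , ⊆[]⇒≡[] (subst (basicSeq f D₂ ⊆_) eq (basicSeq⊆cycle D₁ D₂ C₁ D₁⊆U))
  ... | u ∷ S with basicSeq-≡∷⇒split f D₁ eq
  ... | A₁ , B₁ , b₁ , refl , tb₁≡u , A₁-nonbasic
    with ∈-map-split tail D₂
           (cycle-visits D₂ C₂ D₂⊆U (proj₂ (∈-basicSeq⇒Basic D₁ (subst (u ∈_) (sym eq) (here refl)))))
  ... | A₂ , B₂ , b₂ , refl , tb₂≡u =
    subst₂ Rotation bs-D₁ (sym (basicSeq-++ f A₂ (b₂ ∷ B₂)))
      (rotation-++ (basicSeq f A₂) (basicSeq f (b₂ ∷ B₂)))
    where
    open ≡-Reasoning
    rotations-≡ : basicSeq f (b₁ ∷ B₁ ++ A₁) ≡ basicSeq f (b₂ ∷ B₂ ++ A₂)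
    rotations-≡ = basicSeq-≡-from-same-start (B₁ ++ A₁) (B₂ ++ A₂)
      (cycle-rotate A₁ b₁ B₁ C₁) (cycle-rotate A₂ b₂ B₂ C₂) (trans tb₁≡u (sym tb₂≡u))
      (All-++-comm A₁ (b₁ ∷ B₁) D₁⊆U) (All-++-comm A₂ (b₂ ∷ B₂) D₂⊆U)
    bs-D₁ : basicSeq f (b₂ ∷ B₂) ++ basicSeq f A₂ ≡ u ∷ S
    bs-D₁ = begin
      basicSeq f (b₂ ∷ B₂) ++ basicSeq f A₂   ≡⟨ basicSeq-++ f (b₂ ∷ B₂) A₂ ⟨
      basicSeq f (b₂ ∷ B₂ ++ A₂)              ≡⟨ rotations-≡ ⟨
      basicSeq f (b₁ ∷ B₁ ++ A₁)              ≡⟨ basicSeq-++ f (b₁ ∷ B₁) A₁ ⟩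
      basicSeq f (b₁ ∷ B₁) ++ basicSeq f A₁   ≡⟨ cong (basicSeq f (b₁ ∷ B₁) ++_) A₁-nonbasic ⟩
      basicSeq f (b₁ ∷ B₁) ++ []             ≡⟨ ++-identityʳ _ ⟩
      basicSeq f (b₁ ∷ B₁)                   ≡⟨ cong (_++ basicSeq f (b₁ ∷ B₁)) A₁-nonbasic ⟨
      basicSeq f A₁ ++ basicSeq f (b₁ ∷ B₁)   ≡⟨ basicSeq-++ f A₁ (b₁ ∷ B₁) ⟨
      basicSeq f (A₁ ++ b₁ ∷ B₁)              ≡⟨ eq ⟩
      u ∷ S                                  ∎

-- Only two hypotheses are used: the C i are cycles, and every cycle in their union is concordant.
proposition5p3 :
    (n : ℕ) (prec : Fin n → Fin n → Set) (m : ℕ) (ℓ r : Fin n → ℕ) →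
    IsCanonicalRep prec m ℓ r →
    (f : Arc n → ℚ) → IsCirculation prec ℓ r f →
    (t : ℕ) → 2 ≤ t → (C : Fin t → List (Arc n)) →
    (∀ i → CycleIn f (C i)) →
    (∀ i → Concordant f (C i)) →
    (∀ (D : List (Arc n)) → IsCycle D →
       All (λ a → ∃ λ (i : Fin t) → a ∈ C i) D → Concordant f D) →
    ∀ i j → Rotation (basicSeq f (C i)) (basicSeq f (C j))
proposition5p3 n prec m ℓ r _ f _ t _ C C-cycles _ union-concordant i j =
  cycles-basicSeq-rotation f InUnion union-concordant (C i) (C j)
    (proj₁ (C-cycles i)) (proj₁ (C-cycles j)) (All.tabulate (i ,_)) (All.tabulate (j ,_))
  where
  InUnion : Arc n → Set
  InUnion a = ∃ λ i → a ∈ C i
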